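{- Let $p$ and $q$ be positive integers. A graph $G$ is $(p,q)$-clique-Helly if and only if every $(p+1,q)$-expansion in $G$ has at least $q$ universal vertices.
   Context: Graphs are finite, simple and undirected. A clique is a set of pairwise adjacent vertices; maximal means inclusion-wise maximal. The core of a family of sets is the intersection of its members. A family is $(p,q)$-intersecting if every nonempty subfamily of at most $p$ members has core of cardinality at least $q$, and has the $(p,q)$-Helly property if every nonempty $(p,q)$-intersecting subfamily has core of cardinality at least $q$. A graph is $(p,q)$-clique-Helly if the family of its maximal cliques has the $(p,q)$-Helly property. A vertex $v$ is complete to a vertex set $W$ if $v$ is adjacent to every vertex of $W-\{v\}$. Let $\mathcal Q$ be a family of $p+1$ pairwise different cliques of $G$ of cardinality $q$ each such that the union of any $p$ members of $\mathcal Q$ is a clique of $G$; the $(p+1,q)$-expansion of $\mathcal Q$ in $G$ is the subgraph of $G$ induced by the vertices of $G$ that are complete to at least $p$ members of $\mathcal Q$. A universal vertex of a graph is a vertex adjacent to all other vertices of that graph. -}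

module Defs where

open import Data.Nat using (ℕ; suc; _≤_)
open import Data.Bool using (Bool; true; false)
open import Data.Fin using (Fin)
open import Data.Fin.Subset using (Subset; _∈_; _⊆_; ⋂; ⋃; ∣_∣)
open import Data.List using (List; []; length)
open import Data.List.Relation.Unary.All using (All)
open import Data.List.Membership.Propositional renaming (_∈_ to _∈ˡ_)
open import Data.Product using (Σ; ∃; _×_)
open import Relation.Binary.PropositionalEquality using (_≡_; _≢_)
open import Data.List.Base using (tabulate; filter)
open import Relation.Nullary using (¬_)

record Graph : Set where
  field
    n       : ℕ
    adj     : Fin n → Fin n → Bool
    symmetric   : ∀ u v → adj u v ≡ adj v u
    irreflexive : ∀ v → adj v v ≡ false

module _ (G : Graph) where
  open Graph G

  Adj : Fin n → Fin n → Set
  Adj u v = adj u v ≡ true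

  IsClique : Subset n → Set
  IsClique C = ∀ u v → u ∈ C → v ∈ C → u ≢ v → Adj u v

  IsMaximalClique : Subset n → Set
  IsMaximalClique C = IsClique C × (∀ D → IsClique D → C ⊆ D → D ⊆ C)

  CompleteTo : Fin n → Subset n → Set
  CompleteTo v W = ∀ w → w ∈ W → w ≢ v → Adj v w

core : ∀ {n} → List (Subset n) → Subset n
core = ⋂

-- A family ℱ is (p,q)-intersecting: every nonempty subfamily of at most p
-- members has core of cardinality at least q.  (Subfamilies are lists of
-- members of ℱ; repetitions are harmless, as they change neither the core
-- nor increase the number of distinct members.)
_SubfamilyOf_ : ∀ {n} → List (Subset n) → List (Subset n) → Set
𝓖 SubfamilyOf ℱ = All (_∈ˡ ℱ) 𝓖

Intersecting : ∀ {n} → ℕ → ℕ → List (Subset n) → Set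
Intersecting p q ℱ =
  ∀ 𝓖 → 𝓖 SubfamilyOf ℱ → 𝓖 ≢ [] → length 𝓖 ≤ p → q ≤ ∣ core 𝓖 ∣

CliqueHelly : ℕ → ℕ → Graph → Set
CliqueHelly p q G =
  ∀ (ℱ : List (Subset (Graph.n G))) → All (IsMaximalClique G) ℱ →
    ℱ ≢ [] → Intersecting p q ℱ → q ≤ ∣ core ℱ ∣

module _ (G : Graph) where
  open Graph G

  record ExpansionFamily (p q : ℕ) (𝒬 : Fin (suc p) → Subset n) : Set where
    field
      distinct   : ∀ i j → i ≢ j → 𝒬 i ≢ 𝒬 j
      cliques    : ∀ i → IsClique G (𝒬 i)
      cardinal   : ∀ i → ∣ 𝒬 i ∣ ≡ q
      -- the union of any p members (i.e. of all members but one) is a clique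
      unionsClique : ∀ (S : Subset (suc p)) → ∣ S ∣ ≡ p →
                     ∀ u v → (∃ λ i → i ∈ S × u ∈ 𝒬 i) → (∃ λ j → j ∈ S × v ∈ 𝒬 j) →
                     u ≢ v → Adj G u v

  -- vertex set of the (p+1,q)-expansion: vertices complete to at least p members
  InExpansion : (p : ℕ) → (Fin (suc p) → Subset n) → Fin n → Set
  InExpansion p 𝒬 v =
    ∃ λ (S : Subset (suc p)) → p ≤ ∣ S ∣ × (∀ i → i ∈ S → CompleteTo G v (𝒬 i))

  UniversalInExpansion : (p : ℕ) → (Fin (suc p) → Subset n) → Fin n → Set
  UniversalInExpansion p 𝒬 u =
    InExpansion p 𝒬 u × (∀ w → InExpansion p 𝒬 w → w ≢ u → Adj G u w)

  HasUniversals : (p : ℕ) → (Fin (suc p) → Subset n) → ℕ → Set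
  HasUniversals p 𝒬 q =
    ∃ λ (U : Subset n) → q ≤ ∣ U ∣ × (∀ u → u ∈ U → UniversalInExpansion p 𝒬 u)

-- Forward: let Uₖ be the union of all members of 𝒬 but the k-th. Each Uₖ, and
-- each Uₖ ∪ {w} with w complete to Uₖ, is a clique; extend all of them to maximal
-- cliques. Any p of these maximal cliques come from at most p indices k, so they
-- all contain some 𝒬ₘ: the family is (p,q)-intersecting, and by the Helly
-- property its core has at least q vertices. A core vertex is complete to every
-- 𝒬ₗ (it lies in the clique extending Uₖ for some k ≠ l), and adjacent to every
-- vertex w of the expansion, since w is complete to some Uₖ and both lie in the
-- clique extending Uₖ ∪ {w}.
--
-- Backward: induction on the size of a (p,q)-intersecting family ℱ of maximal
-- cliques. If |ℱ| > p, remove in turn p+1 members B₀,…,Bₚ; by induction each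
-- remaining family has a core of size ≥ q, containing some q-set Qᵢ, so Qᵢ lies
-- in every member of ℱ except possibly Bᵢ. If two Qᵢ coincide, that set lies in
-- the core of ℱ. Otherwise the Qᵢ form an expansion family (all but Qₖ lie in Bₖ)
-- whose expansion contains every member of ℱ, so each universal vertex is
-- complete to, hence by maximality belongs to, every member of ℱ.
module Submission where

open import Defs
open import Data.Nat using (ℕ; suc; _≤_)
open import Data.Fin using (Fin)
open import Data.Fin.Subset using (Subset)
open import Data.Product using (_×_)

open import Function using (_∘_; id)
open import Function.Definitions using (Injective)
open import Data.Nat using (zero; pred; _<_; _∸_; _≤?_; z≤n; s≤s)
open import Data.Nat.Properties using (≤-trans; ≤-reflexive; <⇒≱; ≰⇒>; module ≤-Reasoning)
open import Data.Bool as Bool using (true; false)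
open import Data.Fin using (zero; suc; inject≤; punchIn)
open import Data.Fin.Properties
  using (_≟_; all?; any?; ¬∀⟶∃¬; injective⇒≤; inject≤-injective; punchInᵢ≢i)
open import Data.Fin.Subset
  using (_∈_; _∉_; _⊆_; _∪_; _-_; ∁; ⁅_⁆; ⊤; ∣_∣; inside; outside)
  renaming (⊥ to ∅)
open import Data.Fin.Subset.Properties
  using ( _∈?_; ∈⊤; ∉⊥; ∣⊥∣≡0; ∣⊤∣≡n; x∈⁅x⁆; x∈⁅y⁆⇒x≡y; x≢y⇒x∉⁅y⁆; x∉⁅y⁆⇒x≢y; ∣⁅x⁆∣≡1
        ; ⊆-refl; ⊆-trans; p⊆q⇒∣p∣≤∣q∣; x∈p⇒∣p-x∣<∣p∣; x∈p∧x≢y⇒x∈p-y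
        ; x∈∁p⇒x∉p; x∉p⇒x∈∁p; ∣∁p∣≡n∸∣p∣; x∈p∩q⁺; x∈p∩q⁻; p⊆p∪q; x∈p∪q⁺; x∈p∪q⁻ )
open import Data.List using (List; []; _∷_; length; lookup; removeAt; allFin; map; concatMap)
open import Data.List.Properties using (length-removeAt)
open import Data.List.Relation.Unary.All as All using (All)
open import Data.List.Relation.Unary.Any as Any using (here; there)
open import Data.List.Membership.Propositional using () renaming (_∈_ to _∈ˡ_)
open import Data.List.Membership.Propositional.Properties
  using (∈-lookup; ∈-allFin; ∈-map⁺; ∈-map⁻; ∈-concatMap⁺; ∈-concatMap⁻)
open import Data.Vec using (_∷_; tabulate; here; there)
open import Data.Vec.Properties using (≡-dec; lookup∘tabulate; []=⇒lookup; lookup⇒[]=)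
open import Data.Product using (∃; _,_; proj₁; proj₂; map₂)
open import Data.Sum as Sum using (_⊎_; inj₁; inj₂)
open import Relation.Nullary using (Dec; yes; no; does; ¬?; contradiction)
open import Relation.Nullary.Decidable using (dec-true; dec-false; decidable-stable; _×-dec_; _→-dec_)
open import Relation.Unary using (Decidable)
open import Relation.Binary.PropositionalEquality using (_≡_; _≢_; refl; sym; trans; cong; subst)

setOf : ∀ {n} {P : Fin n → Set} → Decidable P → Subset n
setOf P? = tabulate (does ∘ P?)

module _ {n} {P : Fin n → Set} (P? : Decidable P) where

  ∈-setOf⁺ : ∀ {x} → P x → x ∈ setOf P?
  ∈-setOf⁺ {x} px = lookup⇒[]= x _ (trans (lookup∘tabulate _ x) (dec-true (P? x) px))

  ∈-setOf⁻ : ∀ {x} → x ∈ setOf P? → P x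
  ∈-setOf⁻ {x} x∈ = decidable-stable (P? x) λ ¬px →
    true≢false (trans (sym ([]=⇒lookup x∈)) (trans (lookup∘tabulate _ x) (dec-false (P? x) ¬px)))
    where
    true≢false : true ≢ false
    true≢false ()

∈∁⁅⁆⁺ : ∀ {n} {x y : Fin n} → x ≢ y → x ∈ ∁ ⁅ y ⁆
∈∁⁅⁆⁺ = x∉p⇒x∈∁p ∘ x≢y⇒x∉⁅y⁆

∈∁⁅⁆⁻ : ∀ {n} {x y : Fin n} → x ∈ ∁ ⁅ y ⁆ → x ≢ y
∈∁⁅⁆⁻ = x∉⁅y⁆⇒x≢y ∘ x∈∁p⇒x∉p

∣∁⁅x⁆∣≡n : ∀ {n} (x : Fin (suc n)) → ∣ ∁ ⁅ x ⁆ ∣ ≡ n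
∣∁⁅x⁆∣≡n {n} x = trans (∣∁p∣≡n∸∣p∣ ⁅ x ⁆) (cong (suc n ∸_) (∣⁅x⁆∣≡1 x))

∣p∣<n⇒∃∉ : ∀ {n} (S : Subset n) → ∣ S ∣ < n → ∃ λ x → x ∉ S
∣p∣<n⇒∃∉ {n} S ∣S∣<n with all? (_∈? S)
... | yes all∈ =
  contradiction (subst (_≤ ∣ S ∣) (∣⊤∣≡n n) (p⊆q⇒∣p∣≤∣q∣ {p = ⊤} (λ {x} _ → all∈ x))) (<⇒≱ ∣S∣<n)
... | no ¬all∈ = ¬∀⟶∃¬ n (_∈ S) (_∈? S) ¬all∈

-- Two missing elements x, y would put S inside ∁ ⁅ x ⁆ - y, of size n - 1.
n≤∣p∣⇒missesAtMostOne : ∀ {n} (S : Subset (suc n)) → n ≤ ∣ S ∣ → ∃ λ x → ∀ y → y ≢ x → y ∈ S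
n≤∣p∣⇒missesAtMostOne {n} S n≤∣S∣ with all? (_∈? S)
... | yes all∈ = zero , λ y _ → all∈ y
... | no ¬all∈ with x , x∉S ← ¬∀⟶∃¬ (suc n) (_∈ S) (_∈? S) ¬all∈ =
  x , λ y y≢x → decidable-stable (y ∈? S) λ y∉S → <⇒≱ (∣S∣<n y y≢x y∉S) n≤∣S∣
  where
  ∣S∣<n : ∀ y → y ≢ x → y ∉ S → ∣ S ∣ < n
  ∣S∣<n y y≢x y∉S = begin-strict
    ∣ S ∣              ≤⟨ p⊆q⇒∣p∣≤∣q∣ S⊆ ⟩
    ∣ ∁ ⁅ x ⁆ - y ∣    <⟨ x∈p⇒∣p-x∣<∣p∣ (∈∁⁅⁆⁺ y≢x) ⟩
    ∣ ∁ ⁅ x ⁆ ∣        ≡⟨ ∣∁⁅x⁆∣≡n x ⟩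
    n                  ∎
    where
    open ≤-Reasoning
    S⊆ : S ⊆ ∁ ⁅ x ⁆ - y
    S⊆ z∈S = x∈p∧x≢y⇒x∈p-y (∈∁⁅⁆⁺ λ { refl → x∉S z∈S }) λ { refl → y∉S z∈S }

subsetOfSize : ∀ {n} k (X : Subset n) → k ≤ ∣ X ∣ → ∃ λ Y → Y ⊆ X × ∣ Y ∣ ≡ k
subsetOfSize {n} zero X _ = ∅ , (λ x∈ → contradiction x∈ ∉⊥) , ∣⊥∣≡0 n
subsetOfSize (suc k) (outside ∷ X) k<∣X∣ with Y , Y⊆X , ∣Y∣≡k ← subsetOfSize (suc k) X k<∣X∣ =
  outside ∷ Y , (λ { (there y∈) → there (Y⊆X y∈) }) , ∣Y∣≡k
subsetOfSize (suc k) (inside ∷ X) (s≤s k≤∣X∣) with Y , Y⊆X , ∣Y∣≡k ← subsetOfSize k X k≤∣X∣ =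
  inside ∷ Y , (λ { here → here ; (there y∈) → there (Y⊆X y∈) }) , cong suc ∣Y∣≡k

<⇒notSurjective : ∀ {m n} → m < n → (f : Fin m → Fin n) → ∃ λ y → ∀ x → f x ≢ y
<⇒notSurjective {m} {n} m<n f with all? (λ y → any? (λ x → f x ≟ y))
... | no ¬all-hit = map₂ (λ ¬hit x fx≡y → ¬hit (x , fx≡y))
                      (¬∀⟶∃¬ n _ (λ y → any? (λ x → f x ≟ y)) ¬all-hit)
... | yes all-hit = contradiction (injective⇒≤ section-injective) (<⇒≱ m<n)
  where
  section-injective : Injective _≡_ _≡_ (proj₁ ∘ all-hit)
  section-injective {y} {z} eq =
    trans (sym (proj₂ (all-hit y))) (trans (cong f eq) (proj₂ (all-hit z)))

injective⇒hitsAtMostOnce : ∀ {m n} {f : Fin (suc m) → Fin n} → Injective _≡_ _≡_ f →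
                           ∀ y → ∃ λ c → ∀ i → i ≢ c → f i ≢ y
injective⇒hitsAtMostOnce {f = f} f-injective y with any? (λ c → f c ≟ y)
... | yes (c , fc≡y) = c , λ i i≢c fi≡y → i≢c (f-injective (trans fi≡y (sym fc≡y)))
... | no ¬hit = zero , λ i _ fi≡y → ¬hit (i , fi≡y)

∈-removeAt⁻ : ∀ {A : Set} (xs : List A) i {x} → x ∈ˡ removeAt xs i → x ∈ˡ xs
∈-removeAt⁻ (y ∷ xs) zero x∈ = there x∈
∈-removeAt⁻ (y ∷ xs) (suc i) (here x≡y) = here x≡y
∈-removeAt⁻ (y ∷ xs) (suc i) (there x∈) = there (∈-removeAt⁻ xs i x∈)

lookup∈removeAt : ∀ {A : Set} (xs : List A) i j → j ≢ i → lookup xs j ∈ˡ removeAt xs i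
lookup∈removeAt (y ∷ xs) zero zero j≢i = contradiction refl j≢i
lookup∈removeAt (y ∷ xs) zero (suc j) _ = ∈-lookup j
lookup∈removeAt (y ∷ xs) (suc i) zero _ = here refl
lookup∈removeAt (y ∷ xs) (suc i) (suc j) j≢i = there (lookup∈removeAt xs i j (j≢i ∘ cong suc))

∈-core⁻ : ∀ {n} {x : Fin n} {M ℱ} → x ∈ core ℱ → M ∈ˡ ℱ → x ∈ M
∈-core⁻ {ℱ = M ∷ ℱ} x∈ (here refl) = proj₁ (x∈p∩q⁻ M (core ℱ) x∈)
∈-core⁻ {ℱ = M ∷ ℱ} x∈ (there M∈) = ∈-core⁻ (proj₂ (x∈p∩q⁻ M (core ℱ) x∈)) M∈

∈-core⁺ : ∀ {n} {x : Fin n} ℱ → (∀ j → x ∈ lookup ℱ j) → x ∈ core ℱ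
∈-core⁺ [] _ = ∈⊤
∈-core⁺ (M ∷ ℱ) x∈ = x∈p∩q⁺ (x∈ zero , ∈-core⁺ ℱ (x∈ ∘ suc))

ExpansionsHaveUniversals : ℕ → ℕ → Graph → Set
ExpansionsHaveUniversals p q G =
  ∀ (𝒬 : Fin (suc p) → Subset (Graph.n G)) → ExpansionFamily G p q 𝒬 → HasUniversals G p 𝒬 q

module Cliques (G : Graph) where
  open Graph G

  Adj-sym : ∀ {u v} → Adj G u v → Adj G v u
  Adj-sym {u} {v} u~v = trans (symmetric v u) u~v

  CompleteTo? : ∀ v X → Dec (CompleteTo G v X)
  CompleteTo? v X = all? λ w → (w ∈? X) →-dec (¬? (w ≟ v) →-dec (adj v w Bool.≟ true))

  CompleteTo-anti : ∀ {v X Y} → X ⊆ Y → CompleteTo G v Y → CompleteTo G v X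
  CompleteTo-anti X⊆Y v→Y w w∈X = v→Y w (X⊆Y w∈X)

  IsClique⇒CompleteTo : ∀ {D v X} → IsClique G D → v ∈ D → X ⊆ D → CompleteTo G v X
  IsClique⇒CompleteTo D-clique v∈D X⊆D w w∈X w≢v = D-clique _ w v∈D (X⊆D w∈X) (w≢v ∘ sym)

  ∈-∪⁅⁆⁻ : ∀ {X : Subset n} {v x} → x ∈ X ∪ ⁅ v ⁆ → x ∈ X ⊎ x ≡ v
  ∈-∪⁅⁆⁻ {X} {v} x∈ = Sum.map₂ (x∈⁅y⁆⇒x≡y v) (x∈p∪q⁻ X ⁅ v ⁆ x∈)

  IsClique-∪⁅⁆ : ∀ {X v} → IsClique G X → CompleteTo G v X → IsClique G (X ∪ ⁅ v ⁆)
  IsClique-∪⁅⁆ X-clique v→X a b a∈ b∈ a≢b with ∈-∪⁅⁆⁻ a∈ | ∈-∪⁅⁆⁻ b∈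
  ... | inj₁ a∈X | inj₁ b∈X = X-clique a b a∈X b∈X a≢b
  ... | inj₂ refl | inj₁ b∈X = v→X b b∈X (a≢b ∘ sym)
  ... | inj₁ a∈X | inj₂ refl = Adj-sym (v→X a a∈X a≢b)
  ... | inj₂ refl | inj₂ refl = contradiction refl a≢b

  IsMaximalClique-CompleteTo⇒∈ : ∀ {M v} → IsMaximalClique G M → CompleteTo G v M → v ∈ M
  IsMaximalClique-CompleteTo⇒∈ {M} {v} (M-clique , M-maximal) v→M =
    M-maximal (M ∪ ⁅ v ⁆) (IsClique-∪⁅⁆ M-clique v→M) (p⊆p∪q ⁅ v ⁆) (x∈p∪q⁺ (inj₂ (x∈⁅x⁆ v)))

  addIfComplete : Fin n → Subset n → Subset n
  addIfComplete v X with CompleteTo? v X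
  ... | yes _ = X ∪ ⁅ v ⁆
  ... | no _ = X

  ⊆-addIfComplete : ∀ v X → X ⊆ addIfComplete v X
  ⊆-addIfComplete v X with CompleteTo? v X
  ... | yes _ = p⊆p∪q ⁅ v ⁆
  ... | no _ = id

  ∈-addIfComplete : ∀ {v X} → CompleteTo G v X → v ∈ addIfComplete v X
  ∈-addIfComplete {v} {X} v→X with CompleteTo? v X
  ... | yes _ = x∈p∪q⁺ (inj₂ (x∈⁅x⁆ v))
  ... | no ¬v→X = contradiction v→X ¬v→X

  addIfComplete-clique : ∀ {v X} → IsClique G X → IsClique G (addIfComplete v X)
  addIfComplete-clique {v} {X} X-clique with CompleteTo? v X
  ... | yes v→X = IsClique-∪⁅⁆ X-clique v→X
  ... | no _ = X-clique

  saturate : List (Fin n) → Subset n → Subset n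
  saturate [] X = X
  saturate (v ∷ vs) X = saturate vs (addIfComplete v X)

  ⊆-saturate : ∀ vs X → X ⊆ saturate vs X
  ⊆-saturate [] X = id
  ⊆-saturate (v ∷ vs) X = ⊆-trans (⊆-addIfComplete v X) (⊆-saturate vs _)

  saturate-clique : ∀ vs {X} → IsClique G X → IsClique G (saturate vs X)
  saturate-clique [] X-clique = X-clique
  saturate-clique (v ∷ vs) X-clique = saturate-clique vs (addIfComplete-clique X-clique)

  -- A vertex complete to the result was complete to the stage at which it was visited.
  ∈-saturate : ∀ {v vs X} → v ∈ˡ vs → CompleteTo G v (saturate vs X) → v ∈ saturate vs X
  ∈-saturate {vs = v ∷ vs} {X} (here refl) v→ =
    ⊆-saturate vs _
      (∈-addIfComplete (CompleteTo-anti (⊆-trans (⊆-addIfComplete v X) (⊆-saturate vs _)) v→))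
  ∈-saturate {vs = w ∷ vs} (there v∈) v→ = ∈-saturate v∈ v→

  maximalExtension : Subset n → Subset n
  maximalExtension = saturate (allFin n)

  ⊆-maximalExtension : ∀ X → X ⊆ maximalExtension X
  ⊆-maximalExtension = ⊆-saturate (allFin n)

  maximalExtension-maximal : ∀ {X} → IsClique G X → IsMaximalClique G (maximalExtension X)
  maximalExtension-maximal X-clique =
    saturate-clique (allFin n) X-clique ,
    λ D D-clique M⊆D {v} v∈D → ∈-saturate (∈-allFin v) (IsClique⇒CompleteTo D-clique v∈D M⊆D)

  allButOne⇒InExpansion : ∀ {p v} {𝒬 : Fin (suc p) → Subset n} c →
                          (∀ i → i ≢ c → CompleteTo G v (𝒬 i)) → InExpansion G p 𝒬 v
  allButOne⇒InExpansion c v→𝒬 =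
    ∁ ⁅ c ⁆ , ≤-reflexive (sym (∣∁⁅x⁆∣≡n c)) , λ i i∈ → v→𝒬 i (∈∁⁅⁆⁻ i∈)

module Forward (G : Graph) (p′ q : ℕ) (𝒬 : Fin (suc (suc p′)) → Subset (Graph.n G))
               (𝒬-family : ExpansionFamily G (suc p′) q 𝒬) where
  open Graph G
  open Cliques G
  open ExpansionFamily 𝒬-family

  p : ℕ
  p = suc p′

  InAnotherMember? : ∀ k x → Dec (∃ λ l → l ≢ k × x ∈ 𝒬 l)
  InAnotherMember? k x = any? λ l → ¬? (l ≟ k) ×-dec (x ∈? 𝒬 l)

  U : Fin (suc p) → Subset n
  U k = setOf (InAnotherMember? k)

  𝒬⊆U : ∀ {k l} → l ≢ k → 𝒬 l ⊆ U k
  𝒬⊆U {k} l≢k x∈ = ∈-setOf⁺ (InAnotherMember? k) (_ , l≢k , x∈)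

  U-clique : ∀ k → IsClique G (U k)
  U-clique k u v u∈ v∈ =
    let i , i≢k , u∈𝒬i = ∈-setOf⁻ (InAnotherMember? k) u∈
        j , j≢k , v∈𝒬j = ∈-setOf⁻ (InAnotherMember? k) v∈
    in unionsClique (∁ ⁅ k ⁆) (∣∁⁅x⁆∣≡n k) u v (i , ∈∁⁅⁆⁺ i≢k , u∈𝒬i) (j , ∈∁⁅⁆⁺ j≢k , v∈𝒬j)

  InExpansion⇒CompleteTo-U : ∀ {w} → InExpansion G p 𝒬 w → ∃ λ k → CompleteTo G w (U k)
  InExpansion⇒CompleteTo-U (S , p≤∣S∣ , w→S) with k , S∋ ← n≤∣p∣⇒missesAtMostOne S p≤∣S∣ =
    k , λ y y∈ → let l , l≢k , y∈𝒬l = ∈-setOf⁻ (InAnotherMember? k) y∈ in w→S l (S∋ l l≢k) y y∈𝒬l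

  seeds : Fin (suc p) → List (Subset n)
  seeds k = U k ∷ map (λ w → addIfComplete w (U k)) (allFin n)

  seed-clique : ∀ {k X} → X ∈ˡ seeds k → IsClique G X × U k ⊆ X
  seed-clique {k} (here refl) = U-clique k , ⊆-refl
  seed-clique {k} (there X∈) with w , _ , refl ← ∈-map⁻ _ X∈ =
    addIfComplete-clique (U-clique k) , ⊆-addIfComplete w (U k)

  ℱ : List (Subset n)
  ℱ = concatMap (map maximalExtension ∘ seeds) (allFin (suc p))

  seed∈ℱ : ∀ {k X} → X ∈ˡ seeds k → maximalExtension X ∈ˡ ℱ
  seed∈ℱ {k} X∈ = ∈-concatMap⁺ (map maximalExtension ∘ seeds)
    (Any.map (λ { refl → ∈-map⁺ maximalExtension X∈ }) (∈-allFin k))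

  member : ∀ {M} → M ∈ˡ ℱ → ∃ λ k → IsMaximalClique G M × U k ⊆ M
  member M∈
    with k , M∈k ← Any.satisfied (∈-concatMap⁻ (map maximalExtension ∘ seeds) {xs = allFin (suc p)} M∈)
    with X , X∈ , refl ← ∈-map⁻ maximalExtension M∈k =
    k , maximalExtension-maximal (proj₁ (seed-clique {k} X∈)) ,
    ⊆-trans (proj₂ (seed-clique {k} X∈)) (⊆-maximalExtension X)

  memberAt : ∀ {𝓖} → 𝓖 SubfamilyOf ℱ → ∀ j →
             ∃ λ k → IsMaximalClique G (lookup 𝓖 j) × U k ⊆ lookup 𝓖 j
  memberAt 𝓖⊆ℱ j = member (All.lookup 𝓖⊆ℱ (∈-lookup j))

  unusedClass⊆core : ∀ {𝓖} (𝓖⊆ℱ : 𝓖 SubfamilyOf ℱ) m → (∀ j → proj₁ (memberAt 𝓖⊆ℱ j) ≢ m) →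
                     𝒬 m ⊆ core 𝓖
  unusedClass⊆core {𝓖} 𝓖⊆ℱ m m∉class x∈ = ∈-core⁺ 𝓖 λ j →
    proj₂ (proj₂ (memberAt 𝓖⊆ℱ j)) (𝒬⊆U (m∉class j ∘ sym) x∈)

  ℱ-intersecting : Intersecting p q ℱ
  ℱ-intersecting 𝓖 𝓖⊆ℱ _ ∣𝓖∣≤p =
    let m , m∉class = <⇒notSurjective (s≤s ∣𝓖∣≤p) (proj₁ ∘ memberAt 𝓖⊆ℱ)
    in subst (_≤ ∣ core 𝓖 ∣) (cardinal m) (p⊆q⇒∣p∣≤∣q∣ (unusedClass⊆core 𝓖⊆ℱ m m∉class))

  core-complete : ∀ {u} l → u ∈ core ℱ → CompleteTo G u (𝒬 l)
  core-complete l u∈ =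
    IsClique⇒CompleteTo (proj₁ (maximalExtension-maximal (U-clique k)))
      (∈-core⁻ u∈ (seed∈ℱ {k} (here refl)))
      (⊆-trans (𝒬⊆U (punchInᵢ≢i l zero ∘ sym)) (⊆-maximalExtension (U k)))
    where
    k = punchIn l zero

  core-adjacent : ∀ {u w} → u ∈ core ℱ → InExpansion G p 𝒬 w → w ≢ u → Adj G u w
  core-adjacent {u} {w} u∈ w∈ w≢u with k , w→Uk ← InExpansion⇒CompleteTo-U w∈ =
    proj₁ (maximalExtension-maximal (addIfComplete-clique (U-clique k))) u w
      (∈-core⁻ u∈ (seed∈ℱ {k} (there (∈-map⁺ (λ w → addIfComplete w (U k)) (∈-allFin w)))))
      (⊆-maximalExtension _ (∈-addIfComplete w→Uk)) (w≢u ∘ sym)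

  universals : CliqueHelly p q G → HasUniversals G p 𝒬 q
  universals helly =
    core ℱ , helly ℱ (All.tabulate (proj₁ ∘ proj₂ ∘ member)) (λ ()) ℱ-intersecting ,
    λ u u∈ → allButOne⇒InExpansion zero (λ l _ → core-complete l u∈) ,
             λ w w∈ w≢u → core-adjacent u∈ w∈ w≢u

module NearCores (G : Graph) (p′ q : ℕ) (ℱ : List (Subset (Graph.n G)))
                 (ℱ-maximal : All (IsMaximalClique G) ℱ)
                 (ι : Fin (suc (suc p′)) → Fin (length ℱ)) (ι-injective : Injective _≡_ _≡_ ι)
                 (Q : Fin (suc (suc p′)) → Subset (Graph.n G))
                 (Q⊆ : ∀ i j → j ≢ ι i → Q i ⊆ lookup ℱ j) where
  open Graph G
  open Cliques G

  p : ℕ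
  p = suc p′

  member-maximal : ∀ j → IsMaximalClique G (lookup ℱ j)
  member-maximal j = All.lookup ℱ-maximal (∈-lookup j)

  Q⊆member : ∀ {i k} → k ≢ i → Q i ⊆ lookup ℱ (ι k)
  Q⊆member k≢i = Q⊆ _ _ (k≢i ∘ ι-injective)

  expansionFamily : (∀ i j → i ≢ j → Q i ≢ Q j) → (∀ i → ∣ Q i ∣ ≡ q) → ExpansionFamily G p q Q
  expansionFamily distinct ∣Q∣≡q = record
    { distinct = distinct
    ; cliques = λ i u v u∈ v∈ →
        proj₁ (member-maximal (ι (punchIn i zero))) u v
          (Q⊆member (punchInᵢ≢i i zero) u∈) (Q⊆member (punchInᵢ≢i i zero) v∈)
    ; cardinal = ∣Q∣≡q
    ; unionsClique = λ S ∣S∣≡p u v (i , i∈S , u∈) (j , j∈S , v∈) →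
        let k , k∉S = ∣p∣<n⇒∃∉ S (≤-reflexive (cong suc ∣S∣≡p))
        in proj₁ (member-maximal (ι k)) u v
             (Q⊆member (λ { refl → k∉S i∈S }) u∈) (Q⊆member (λ { refl → k∉S j∈S }) v∈)
    }

  member⊆expansion : ∀ j {x} → x ∈ lookup ℱ j → InExpansion G p Q x
  member⊆expansion j x∈ with c , ι-avoids ← injective⇒hitsAtMostOnce ι-injective j =
    allButOne⇒InExpansion c λ i i≢c →
      IsClique⇒CompleteTo (proj₁ (member-maximal j)) x∈ (Q⊆ i j (ι-avoids i i≢c ∘ sym))

  universal∈core : ∀ {u} → UniversalInExpansion G p Q u → u ∈ core ℱ
  universal∈core (_ , u-adjacent) = ∈-core⁺ ℱ λ j →
    IsMaximalClique-CompleteTo⇒∈ (member-maximal j)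
      λ w w∈ w≢u → u-adjacent w (member⊆expansion j w∈) w≢u

  duplicate⊆core : ∀ {i k} → i ≢ k → Q i ≡ Q k → Q i ⊆ core ℱ
  duplicate⊆core {i} {k} i≢k Qi≡Qk {x} x∈ = ∈-core⁺ ℱ in-member
    where
    in-member : ∀ j → x ∈ lookup ℱ j
    in-member j with j ≟ ι i
    ... | yes refl = Q⊆ k (ι i) (i≢k ∘ ι-injective) (subst (x ∈_) Qi≡Qk x∈)
    ... | no j≢ιi = Q⊆ i j j≢ιi x∈

  core-large : ExpansionsHaveUniversals p q G → (∀ i → ∣ Q i ∣ ≡ q) → q ≤ ∣ core ℱ ∣
  core-large hyp ∣Q∣≡q with any? (λ i → any? (λ k → ¬? (i ≟ k) ×-dec ≡-dec Bool._≟_ (Q i) (Q k)))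
  ... | yes (i , k , i≢k , Qi≡Qk) =
    subst (_≤ ∣ core ℱ ∣) (∣Q∣≡q i) (p⊆q⇒∣p∣≤∣q∣ (duplicate⊆core i≢k Qi≡Qk))
  ... | no ¬duplicate =
    let distinct = λ i k i≢k Qi≡Qk → ¬duplicate (i , k , i≢k , Qi≡Qk)
        U , q≤∣U∣ , U-universal = hyp Q (expansionFamily distinct ∣Q∣≡q)
    in ≤-trans q≤∣U∣ (p⊆q⇒∣p∣≤∣q∣ (λ u∈ → universal∈core (U-universal _ u∈)))

module Backward (G : Graph) (p′ q : ℕ) (hyp : ExpansionsHaveUniversals (suc p′) q G) where
  open Graph G

  p : ℕ
  p = suc p′

  helly-by-length : ∀ m ℱ → length ℱ ≡ m → All (IsMaximalClique G) ℱ → ℱ ≢ [] →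
                    Intersecting p q ℱ → q ≤ ∣ core ℱ ∣
  helly-by-length m ℱ ∣ℱ∣≡m _ ℱ≢[] intersecting with m ≤? p
  ... | yes m≤p = intersecting ℱ (All.tabulate id) ℱ≢[] (subst (_≤ p) (sym ∣ℱ∣≡m) m≤p)
  helly-by-length zero ℱ _ _ _ _ | no 0≰p = contradiction z≤n 0≰p
  helly-by-length (suc m) ℱ ∣ℱ∣≡1+m maximal _ intersecting | no 1+m≰p =
    NearCores.core-large G p′ q ℱ maximal ι (inject≤-injective _ _ _ _) Q Q⊆ hyp ∣Q∣≡q
    where
    1+p≤∣ℱ∣ : suc p ≤ length ℱ
    1+p≤∣ℱ∣ = subst (suc p ≤_) (sym ∣ℱ∣≡1+m) (≰⇒> 1+m≰p)

    ι : Fin (suc p) → Fin (length ℱ)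
    ι i = inject≤ i 1+p≤∣ℱ∣

    R : Fin (suc p) → List (Subset n)
    R i = removeAt ℱ (ι i)

    ∣R∣≡m : ∀ i → length (R i) ≡ m
    ∣R∣≡m i = trans (length-removeAt ℱ (ι i)) (cong pred ∣ℱ∣≡1+m)

    R≢[] : ∀ i → R i ≢ []
    R≢[] i R≡[] with s≤s p≤m ← ≰⇒> 1+m≰p
      with () ← subst (p ≤_) (trans (sym (∣R∣≡m i)) (cong length R≡[])) p≤m

    core-R-large : ∀ i → q ≤ ∣ core (R i) ∣
    core-R-large i =
      helly-by-length m (R i) (∣R∣≡m i)
        (All.tabulate (All.lookup maximal ∘ ∈-removeAt⁻ ℱ (ι i))) (R≢[] i)
        (λ 𝓖 𝓖⊆R → intersecting 𝓖 (All.map (∈-removeAt⁻ ℱ (ι i)) 𝓖⊆R))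

    Q : Fin (suc p) → Subset n
    Q i = proj₁ (subsetOfSize q (core (R i)) (core-R-large i))

    ∣Q∣≡q : ∀ i → ∣ Q i ∣ ≡ q
    ∣Q∣≡q i = proj₂ (proj₂ (subsetOfSize q (core (R i)) (core-R-large i)))

    Q⊆ : ∀ i j → j ≢ ι i → Q i ⊆ lookup ℱ j
    Q⊆ i j j≢ιi x∈ =
      ∈-core⁻ (proj₁ (proj₂ (subsetOfSize q (core (R i)) (core-R-large i))) x∈)
        (lookup∈removeAt ℱ (ι i) j j≢ιi)

  helly : CliqueHelly p q G
  helly ℱ = helly-by-length _ ℱ refl

theorem3p5 : (p q : ℕ) → 1 ≤ p → 1 ≤ q → (G : Graph) →
    (CliqueHelly p q G →
      ∀ (𝒬 : Fin (suc p) → Subset (Graph.n G)) → ExpansionFamily G p q 𝒬 →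
        HasUniversals G p 𝒬 q)
    ×
    ((∀ (𝒬 : Fin (suc p) → Subset (Graph.n G)) → ExpansionFamily G p q 𝒬 →
        HasUniversals G p 𝒬 q) →
      CliqueHelly p q G)
theorem3p5 zero q () _ G
theorem3p5 (suc p′) q _ _ G =
  (λ helly 𝒬 𝒬-family → Forward.universals G p′ q 𝒬 𝒬-family helly) ,
  Backward.helly G p′ q
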